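{- Let $n\geq 4$, let $C=\operatorname{circ}(1,0,\ldots,0,-1)$ be the circulant matrix of order $n-1$, let $X=(CC^T+I_{n-1})^{ -1}(J_{n-1}-nI_{n-1})$ and $Y=-C^TX$. Then $Y=\operatorname{circ}(d_0,d_1,\ldots,d_{n-2})$, where \[d_0=\frac{2n}{\sqrt{5}}\left[\frac{(3+\sqrt{5})^{n-2}-2^{n-2}}{2^{n-1}-(3+\sqrt{5})^{n-1}} -\frac{(3-\sqrt{5})^{n-2}-2^{n-2}}{2^{n-1}-(3-\sqrt{5})^{n-1}}\right]\] and for $j=1,2,\ldots,n-2$, \[d_j=-\frac{n2^{n-j}}{5+\sqrt{5}}\left[\frac{(3+\sqrt{5})^{j}}{2^{n-1}-(3+\sqrt{5})^{n-1}} +\frac{2(3-\sqrt{5})^{j-1}}{2^{n-1}-(3-\sqrt{5})^{n-1}}\right].\]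
   Context: For real numbers $c_0,\ldots,c_{k-1}$, $\operatorname{circ}(c_0,c_1,\ldots,c_{k-1})$ denotes the $k\times k$ circulant matrix whose $(i,j)$-entry is $c_{(j-i)\bmod k}$. $I_k$ is the $k\times k$ identity matrix and $J_k$ the $k\times k$ all-ones matrix. -}

module Defs where

open import Data.Nat as ℕ using (ℕ; zero; suc; pred)
open import Data.Nat.DivMod using (_mod_)
open import Data.Fin as Fin using (Fin; toℕ)
open import Data.Integer using (+_)
open import Data.Rational as ℚ using (ℚ; 0ℚ; 1ℚ; _/_)
open import Data.Bool using (if_then_else_)
open import Relation.Binary.PropositionalEquality using (_≡_; refl)
open import Relation.Nullary using (yes; no)

Matrix : ℕ → Set
Matrix k = Fin k → Fin k → ℚ

sumFin : ∀ {k} → (Fin k → ℚ) → ℚ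
sumFin {zero}  f = 0ℚ
sumFin {suc k} f = f Fin.zero ℚ.+ sumFin (λ i → f (Fin.suc i))

_⊗_ : ∀ {k} → Matrix k → Matrix k → Matrix k
(A ⊗ B) i j = sumFin (λ l → A i l ℚ.* B l j)

_⊕_ : ∀ {k} → Matrix k → Matrix k → Matrix k
(A ⊕ B) i j = A i j ℚ.+ B i j

_⊖_ : ∀ {k} → Matrix k → Matrix k → Matrix k
(A ⊖ B) i j = A i j ℚ.- B i j

neg : ∀ {k} → Matrix k → Matrix k
neg A i j = ℚ.- A i j

_·_ : ∀ {k} → ℚ → Matrix k → Matrix k
(c · A) i j = c ℚ.* A i j

transpose : ∀ {k} → Matrix k → Matrix k
transpose A i j = A j i

I : ∀ k → Matrix k
I k i j with toℕ i ℕ.≟ toℕ j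
... | yes _ = 1ℚ
... | no  _ = 0ℚ

J : ∀ k → Matrix k
J k i j = 1ℚ

ℕ→ℚ : ℕ → ℚ
ℕ→ℚ n = (+ n) / 1

-- circ(c_0,…,c_{k-1}) : (i,j)-entry c_{(j-i) mod k}, entries in any type
circ : ∀ {A : Set} (k : ℕ) → (Fin k → A) → Fin k → Fin k → A
circ zero    c () j
circ (suc k) c i j = c ((toℕ j ℕ.+ suc k ℕ.∸ toℕ i) mod suc k)

-- coefficient list (1,0,…,0,-1) of length k (k ≥ 2)
cC : ∀ k → Fin k → ℚ
cC k i with toℕ i ℕ.≟ 0
... | yes _ = 1ℚ
... | no  _ with toℕ i ℕ.≟ pred k
...   | yes _ = ℚ.- 1ℚ
...   | no  _ = 0ℚ

Cmat : ∀ k → Matrix k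
Cmat k = circ k (cC k)

record Q5 : Set where
  constructor _+_√5
  field
    re : ℚ
    ir : ℚ
open Q5

ι : ℚ → Q5
ι q = q + 0ℚ √5

√5 : Q5
√5 = 0ℚ + 1ℚ √5

infixl 6 _+₅_ _-₅_
infixl 7 _*₅_ _÷₅_

_+₅_ : Q5 → Q5 → Q5
(a + b √5) +₅ (c + d √5) = (a ℚ.+ c) + (b ℚ.+ d) √5

-₅_ : Q5 → Q5
-₅ (a + b √5) = (ℚ.- a) + (ℚ.- b) √5

_-₅_ : Q5 → Q5 → Q5
x -₅ y = x +₅ (-₅ y)

_*₅_ : Q5 → Q5 → Q5
(a + b √5) *₅ (c + d √5) =
  (a ℚ.* c ℚ.+ ℕ→ℚ 5 ℚ.* (b ℚ.* d)) + (a ℚ.* d ℚ.+ b ℚ.* c) √5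

_^₅_ : Q5 → ℕ → Q5
x ^₅ zero  = ι 1ℚ
x ^₅ suc n = x *₅ (x ^₅ n)

-- total reciprocal on ℚ (value at 0 irrelevant: only used on nonzero arguments)
recipℚ : ℚ → ℚ
recipℚ q with q ℚ.≟ 0ℚ
... | yes _  = 0ℚ
... | no q≢0 = ℚ.1/_ q {{ℚ.≢-nonZero q≢0}}

-- reciprocal in ℚ(√5): (a + b√5)⁻¹ = (a - b√5)/(a² - 5b²)
inv₅ : Q5 → Q5
inv₅ (a + b √5) = (a ℚ.* r) + (ℚ.- b ℚ.* r) √5
  where r = recipℚ (a ℚ.* a ℚ.- ℕ→ℚ 5 ℚ.* (b ℚ.* b))

_÷₅_ : Q5 → Q5 → Q5
x ÷₅ y = x *₅ inv₅ y

n₅ : ℕ → Q5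
n₅ n = ι (ℕ→ℚ n)

d₀ : ℕ → Q5
d₀ n = ((n₅ 2 *₅ n₅ n) ÷₅ √5) *₅
  ( ((p ^₅ (n ℕ.∸ 2) -₅ n₅ 2 ^₅ (n ℕ.∸ 2)) ÷₅ (n₅ 2 ^₅ (n ℕ.∸ 1) -₅ p ^₅ (n ℕ.∸ 1)))
  -₅ ((m ^₅ (n ℕ.∸ 2) -₅ n₅ 2 ^₅ (n ℕ.∸ 2)) ÷₅ (n₅ 2 ^₅ (n ℕ.∸ 1) -₅ m ^₅ (n ℕ.∸ 1))))
  where
  p = n₅ 3 +₅ √5
  m = n₅ 3 -₅ √5

dⱼ : ℕ → ℕ → Q5
dⱼ n j = -₅ ((n₅ n *₅ n₅ 2 ^₅ (n ℕ.∸ j)) ÷₅ (n₅ 5 +₅ √5)) *₅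
  ( (p ^₅ j ÷₅ (n₅ 2 ^₅ (n ℕ.∸ 1) -₅ p ^₅ (n ℕ.∸ 1)))
  +₅ ((n₅ 2 *₅ m ^₅ (j ℕ.∸ 1)) ÷₅ (n₅ 2 ^₅ (n ℕ.∸ 1) -₅ m ^₅ (n ℕ.∸ 1))))
  where
  p = n₅ 3 +₅ √5
  m = n₅ 3 -₅ √5

dvec : (n : ℕ) → Fin (pred n) → Q5
dvec n j with toℕ j
... | zero  = d₀ n
... | suc i = dⱼ n (suc i)

-- Write D for the circulant with first row d = (d₀, …, d_{n-2}) and W = J - nI. Since Cᵀ J = 0, the
-- matrix Z = W + C D satisfies Cᵀ Z = -D as soon as d obeys the cyclic recurrence
-- 3 d_t - d_{t+1} - d_{t-1} = n (δ_{t0} - δ_{t1}) (indices mod n - 1), and then M Z = C Cᵀ Z + Z = W,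
-- so any left inverse of M sends W to Z and Y = -Cᵀ Z = D.  The closed form is d_j = f_{j-1} for j ≥ 1
-- and d₀ = f_{n-2}, where f_j = c (α^{j+1} u + β^j v) with α, β = (3 ± √5)/2 the roots of x² - 3x + 1;
-- so f solves the recurrence away from the wrap-around, and the two wrap-around equations hold because
-- u, v are the inverses of 2^{n-1} - (3 ± √5)^{n-1}.  Everything is computed in ℚ(√5): the d_j are
-- rational because they are fixed by conjugation, and the denominators do not vanish because
-- N(2^m - (3 + √5)^m) = -2^{m+1} (Re (3 + √5)^m - 2^m) < 0.

module Submission where

open import Defs
open import Level using (0ℓ)
open import Data.Nat as ℕ using (ℕ; zero; suc; _≤_; _<_; pred; s≤s; z≤n; _∸_; _%_)
import Data.Nat.Properties as ℕP
open import Data.Nat.DivMod using (_mod_; m<n⇒m%n≡m; n%n≡0; [m+n]%n≡m%n; %-distribˡ-+; m%n<n; m%n%n≡m%n)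
open import Data.Fin as Fin using (Fin; toℕ; fromℕ<)
open import Data.Fin.Properties using (toℕ-fromℕ<; toℕ-injective; toℕ<n)
open import Data.Integer using (+_)
open import Data.Rational as ℚ using (ℚ; 0ℚ; 1ℚ; _/_; Positive; NonNegative)
import Data.Rational.Properties as ℚP
open import Data.Rational.Solver using (module +-*-Solver)
open import Data.Product using (_×_; _,_; proj₁; proj₂)
open import Data.Sum using (_⊎_; inj₁; inj₂)
open import Data.Empty using (⊥-elim)
open import Relation.Nullary using (yes; no; Dec)
open import Relation.Binary.Definitions using (DecidableEquality)
open import Relation.Binary.PropositionalEquality hiding (J)
open import Algebra.Bundles using (CommutativeRing)
open import Algebra.Structures {A = Q5} _≡_ using (IsCommutativeRing)
import Algebra.Solver.Ring.AlmostCommutativeRing as ACR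
import Algebra.Solver.Ring.Simple as RingSolver
open Q5

module ℚ-Solver = +-*-Solver

module _ where
  open ℚ-Solver

  +₅-assoc : ∀ x y z → (x +₅ y) +₅ z ≡ x +₅ (y +₅ z)
  +₅-assoc (a + b √5) (c + d √5) (e + f √5) = cong₂ _+_√5 (ℚP.+-assoc a c e) (ℚP.+-assoc b d f)

  +₅-comm : ∀ x y → x +₅ y ≡ y +₅ x
  +₅-comm (a + b √5) (c + d √5) = cong₂ _+_√5 (ℚP.+-comm a c) (ℚP.+-comm b d)

  +₅-identityˡ : ∀ x → ι 0ℚ +₅ x ≡ x
  +₅-identityˡ (a + b √5) = cong₂ _+_√5 (ℚP.+-identityˡ a) (ℚP.+-identityˡ b)

  +₅-identityʳ : ∀ x → x +₅ ι 0ℚ ≡ x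
  +₅-identityʳ (a + b √5) = cong₂ _+_√5 (ℚP.+-identityʳ a) (ℚP.+-identityʳ b)

  -₅-inverseˡ : ∀ x → (-₅ x) +₅ x ≡ ι 0ℚ
  -₅-inverseˡ (a + b √5) = cong₂ _+_√5 (ℚP.+-inverseˡ a) (ℚP.+-inverseˡ b)

  -₅-inverseʳ : ∀ x → x +₅ (-₅ x) ≡ ι 0ℚ
  -₅-inverseʳ (a + b √5) = cong₂ _+_√5 (ℚP.+-inverseʳ a) (ℚP.+-inverseʳ b)

  *₅-assoc : ∀ x y z → (x *₅ y) *₅ z ≡ x *₅ (y *₅ z)
  *₅-assoc (a + b √5) (c + d √5) (e + f √5) = cong₂ _+_√5
    (solve 7 (λ a b c d e f s →
        (a :* c :+ s :* (b :* d)) :* e :+ s :* ((a :* d :+ b :* c) :* f)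
      := a :* (c :* e :+ s :* (d :* f)) :+ s :* (b :* (c :* f :+ d :* e))) refl a b c d e f (ℕ→ℚ 5))
    (solve 7 (λ a b c d e f s →
        (a :* c :+ s :* (b :* d)) :* f :+ (a :* d :+ b :* c) :* e
      := a :* (c :* f :+ d :* e) :+ b :* (c :* e :+ s :* (d :* f))) refl a b c d e f (ℕ→ℚ 5))

  *₅-comm : ∀ x y → x *₅ y ≡ y *₅ x
  *₅-comm (a + b √5) (c + d √5) = cong₂ _+_√5
    (cong₂ ℚ._+_ (ℚP.*-comm a c) (cong (ℕ→ℚ 5 ℚ.*_) (ℚP.*-comm b d)))
    (trans (ℚP.+-comm (a ℚ.* d) (b ℚ.* c)) (cong₂ ℚ._+_ (ℚP.*-comm b c) (ℚP.*-comm a d)))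

  *₅-identityˡ : ∀ x → ι 1ℚ *₅ x ≡ x
  *₅-identityˡ (a + b √5) = cong₂ _+_√5
    (solve 3 (λ a b s → con 1ℚ :* a :+ s :* (con 0ℚ :* b) := a) refl a b (ℕ→ℚ 5))
    (solve 2 (λ a b → con 1ℚ :* b :+ con 0ℚ :* a := b) refl a b)

  *₅-identityʳ : ∀ x → x *₅ ι 1ℚ ≡ x
  *₅-identityʳ x = trans (*₅-comm x (ι 1ℚ)) (*₅-identityˡ x)

  *₅-distribˡ-+₅ : ∀ x y z → x *₅ (y +₅ z) ≡ x *₅ y +₅ x *₅ z
  *₅-distribˡ-+₅ (a + b √5) (c + d √5) (e + f √5) = cong₂ _+_√5
    (solve 7 (λ a b c d e f s →
        a :* (c :+ e) :+ s :* (b :* (d :+ f))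
      := (a :* c :+ s :* (b :* d)) :+ (a :* e :+ s :* (b :* f))) refl a b c d e f (ℕ→ℚ 5))
    (solve 6 (λ a b c d e f →
        a :* (d :+ f) :+ b :* (c :+ e)
      := (a :* d :+ b :* c) :+ (a :* f :+ b :* e)) refl a b c d e f)

  *₅-distribʳ-+₅ : ∀ x y z → (y +₅ z) *₅ x ≡ y *₅ x +₅ z *₅ x
  *₅-distribʳ-+₅ x y z = begin
    (y +₅ z) *₅ x       ≡⟨ *₅-comm (y +₅ z) x ⟩
    x *₅ (y +₅ z)       ≡⟨ *₅-distribˡ-+₅ x y z ⟩
    x *₅ y +₅ x *₅ z    ≡⟨ cong₂ _+₅_ (*₅-comm x y) (*₅-comm x z) ⟩
    y *₅ x +₅ z *₅ x    ∎
    where open ≡-Reasoning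

Q5-isCommutativeRing : IsCommutativeRing _+₅_ _*₅_ -₅_ (ι 0ℚ) (ι 1ℚ)
Q5-isCommutativeRing = record
  { isRing = record
    { +-isAbelianGroup = record
      { isGroup = record
        { isMonoid = record
          { isSemigroup = record
            { isMagma = record { isEquivalence = isEquivalence ; ∙-cong = cong₂ _+₅_ }
            ; assoc = +₅-assoc }
          ; identity = +₅-identityˡ , +₅-identityʳ }
        ; inverse = -₅-inverseˡ , -₅-inverseʳ
        ; ⁻¹-cong = cong (λ x → -₅ x) }
      ; comm = +₅-comm }
    ; *-cong = cong₂ _*₅_
    ; *-assoc = *₅-assoc
    ; *-identity = *₅-identityˡ , *₅-identityʳ
    ; distrib = *₅-distribˡ-+₅ , *₅-distribʳ-+₅ }
  ; *-comm = *₅-comm }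

Q5-commutativeRing : CommutativeRing 0ℓ 0ℓ
Q5-commutativeRing = record { isCommutativeRing = Q5-isCommutativeRing }

_≟₅_ : DecidableEquality Q5
(a + b √5) ≟₅ (c + d √5) with a ℚP.≟ c | b ℚP.≟ d
... | yes refl | yes refl = yes refl
... | no a≢c   | _        = no (λ x≡y → a≢c (cong re x≡y))
... | yes _    | no b≢d   = no (λ x≡y → b≢d (cong ir x≡y))

module Q5-Solver = RingSolver (ACR.fromCommutativeRing Q5-commutativeRing) _≟₅_

^₅-+ : ∀ x a b → x ^₅ (a ℕ.+ b) ≡ x ^₅ a *₅ x ^₅ b
^₅-+ x zero    b = sym (*₅-identityˡ (x ^₅ b))
^₅-+ x (suc a) b = trans (cong (x *₅_) (^₅-+ x a b)) (sym (*₅-assoc x (x ^₅ a) (x ^₅ b)))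

^₅-distrib-*₅ : ∀ x y a → (x *₅ y) ^₅ a ≡ x ^₅ a *₅ y ^₅ a
^₅-distrib-*₅ x y zero    = refl
^₅-distrib-*₅ x y (suc a) = trans (cong ((x *₅ y) *₅_) (^₅-distrib-*₅ x y a))
  (solve 4 (λ x y X Y → (x :* y) :* (X :* Y) := (x :* X) :* (y :* Y)) refl x y (x ^₅ a) (y ^₅ a))
  where open Q5-Solver

conj : Q5 → Q5
conj (a + b √5) = a + (ℚ.- b) √5

norm : Q5 → ℚ
norm (a + b √5) = a ℚ.* a ℚ.- ℕ→ℚ 5 ℚ.* (b ℚ.* b)

module _ where
  open ℚ-Solver

  conj-+₅ : ∀ x y → conj (x +₅ y) ≡ conj x +₅ conj y
  conj-+₅ (a + b √5) (c + d √5) = cong (λ z → (a ℚ.+ c) + z √5) (ℚP.neg-distrib-+ b d)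

  conj-neg₅ : ∀ x → conj (-₅ x) ≡ -₅ conj x
  conj-neg₅ (a + b √5) = refl

  conj--₅ : ∀ x y → conj (x -₅ y) ≡ conj x -₅ conj y
  conj--₅ x y = trans (conj-+₅ x (-₅ y)) (cong (conj x +₅_) (conj-neg₅ y))

  conj-*₅ : ∀ x y → conj (x *₅ y) ≡ conj x *₅ conj y
  conj-*₅ (a + b √5) (c + d √5) = cong₂ _+_√5
    (solve 5 (λ a b c d s → a :* c :+ s :* (b :* d) := a :* c :+ s :* ((:- b) :* (:- d))) refl a b c d (ℕ→ℚ 5))
    (solve 4 (λ a b c d → :- (a :* d :+ b :* c) := a :* (:- d) :+ (:- b) :* c) refl a b c d)

  conj-fixed⇒rational : ∀ x → conj x ≡ x → ι (re x) ≡ x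
  conj-fixed⇒rational (a + b √5) conj-x≡x = cong (λ z → a + z √5) (sym b≡0)
    where
    b≡0 : b ≡ 0ℚ
    b≡0 = begin
      b                                ≡⟨ solve 1 (λ b → b := con (+ 1 / 2) :* (b :- :- b)) refl b ⟩
      + 1 / 2 ℚ.* (b ℚ.- ℚ.- b)       ≡⟨ cong (λ c → + 1 / 2 ℚ.* (b ℚ.- c)) (cong ir conj-x≡x) ⟩
      + 1 / 2 ℚ.* (b ℚ.- b)           ≡⟨ solve 1 (λ b → con (+ 1 / 2) :* (b :- b) := con 0ℚ) refl b ⟩
      0ℚ                               ∎
      where open ≡-Reasoning

  ι-*₅ : ∀ p q → ι p *₅ ι q ≡ ι (p ℚ.* q)
  ι-*₅ p q = cong₂ _+_√5
    (solve 3 (λ p q s → p :* q :+ s :* (con 0ℚ :* con 0ℚ) := p :* q) refl p q (ℕ→ℚ 5))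
    (solve 2 (λ p q → p :* con 0ℚ :+ con 0ℚ :* q := con 0ℚ) refl p q)

  *₅-conj : ∀ x → x *₅ conj x ≡ ι (norm x)
  *₅-conj (a + b √5) = cong₂ _+_√5
    (solve 3 (λ a b s → a :* a :+ s :* (b :* (:- b)) := a :* a :- s :* (b :* b)) refl a b (ℕ→ℚ 5))
    (solve 2 (λ a b → a :* (:- b) :+ b :* a := con 0ℚ) refl a b)

  norm-*₅ : ∀ x y → norm (x *₅ y) ≡ norm x ℚ.* norm y
  norm-*₅ (a + b √5) (c + d √5) = solve 5 (λ a b c d s →
      (a :* c :+ s :* (b :* d)) :* (a :* c :+ s :* (b :* d)) :- s :* ((a :* d :+ b :* c) :* (a :* d :+ b :* c))
    := (a :* a :- s :* (b :* b)) :* (c :* c :- s :* (d :* d))) refl a b c d (ℕ→ℚ 5)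

  norm-conj : ∀ x → norm (conj x) ≡ norm x
  norm-conj (a + b √5) = cong (λ c → a ℚ.* a ℚ.- ℕ→ℚ 5 ℚ.* c) (solve 1 (λ b → (:- b) :* (:- b) := b :* b) refl b)

  inv₅≡conj*recip-norm : ∀ x → inv₅ x ≡ conj x *₅ ι (recipℚ (norm x))
  inv₅≡conj*recip-norm (a + b √5) = cong₂ _+_√5
    (solve 3 (λ a b r → a :* r := a :* r :+ con (ℕ→ℚ 5) :* ((:- b) :* con 0ℚ)) refl a b (recipℚ (norm (a + b √5))))
    (solve 3 (λ a b r → :- b :* r := a :* con 0ℚ :+ (:- b) :* r) refl a b (recipℚ (norm (a + b √5))))

conj-^₅ : ∀ x a → conj (x ^₅ a) ≡ conj x ^₅ a
conj-^₅ x zero    = refl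
conj-^₅ x (suc a) = trans (conj-*₅ x (x ^₅ a)) (cong (conj x *₅_) (conj-^₅ x a))

conj-inv₅ : ∀ x → conj (inv₅ x) ≡ inv₅ (conj x)
conj-inv₅ x = begin
  conj (inv₅ x)                                   ≡⟨ cong conj (inv₅≡conj*recip-norm x) ⟩
  conj (conj x *₅ ι (recipℚ (norm x)))            ≡⟨ conj-*₅ (conj x) (ι (recipℚ (norm x))) ⟩
  conj (conj x) *₅ ι (recipℚ (norm x))            ≡⟨ cong (λ m → conj (conj x) *₅ ι (recipℚ m)) (norm-conj x) ⟨
  conj (conj x) *₅ ι (recipℚ (norm (conj x)))     ≡⟨ inv₅≡conj*recip-norm (conj x) ⟨
  inv₅ (conj x)                                   ∎
  where open ≡-Reasoning

recipℚ-inverseʳ : ∀ q → q ≢ 0ℚ → q ℚ.* recipℚ q ≡ 1ℚ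
recipℚ-inverseʳ q q≢0 with q ℚ.≟ 0ℚ
... | yes q≡0 = ⊥-elim (q≢0 q≡0)
... | no  _   = ℚP.*-inverseʳ q {{ℚ.≢-nonZero q≢0}}

inv₅-inverseʳ : ∀ x → norm x ≢ 0ℚ → x *₅ inv₅ x ≡ ι 1ℚ
inv₅-inverseʳ x norm≢0 = begin
  x *₅ inv₅ x                                ≡⟨ cong (x *₅_) (inv₅≡conj*recip-norm x) ⟩
  x *₅ (conj x *₅ ι (recipℚ (norm x)))       ≡⟨ *₅-assoc x (conj x) _ ⟨
  x *₅ conj x *₅ ι (recipℚ (norm x))         ≡⟨ cong (_*₅ ι (recipℚ (norm x))) (*₅-conj x) ⟩
  ι (norm x) *₅ ι (recipℚ (norm x))          ≡⟨ ι-*₅ (norm x) (recipℚ (norm x)) ⟩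
  ι (norm x ℚ.* recipℚ (norm x))             ≡⟨ cong ι (recipℚ-inverseʳ (norm x) norm≢0) ⟩
  ι 1ℚ                                       ∎
  where open ≡-Reasoning

pow2 : ℕ → ℚ
pow2 zero    = 1ℚ
pow2 (suc m) = ℕ→ℚ 2 ℚ.* pow2 m

pow2-positive : ∀ m → Positive (pow2 m)
pow2-positive zero    = _
pow2-positive (suc m) = ℚP.pos*pos⇒pos (ℕ→ℚ 2) (pow2 m) {{pow2-positive m}}

n₅2^≡ι-pow2 : ∀ m → n₅ 2 ^₅ m ≡ ι (pow2 m)
n₅2^≡ι-pow2 zero    = refl
n₅2^≡ι-pow2 (suc m) = trans (cong (n₅ 2 *₅_) (n₅2^≡ι-pow2 m)) (ι-*₅ (ℕ→ℚ 2) (pow2 m))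

σ₊ : Q5
σ₊ = n₅ 3 +₅ √5

module _ where
  open ℚ-Solver

  norm-σ₊^ : ∀ m → norm (σ₊ ^₅ m) ≡ pow2 m ℚ.* pow2 m
  norm-σ₊^ zero    = refl
  norm-σ₊^ (suc m) = begin
    norm (σ₊ *₅ σ₊ ^₅ m)                   ≡⟨ norm-*₅ σ₊ (σ₊ ^₅ m) ⟩
    norm σ₊ ℚ.* norm (σ₊ ^₅ m)             ≡⟨ cong (norm σ₊ ℚ.*_) (norm-σ₊^ m) ⟩
    norm σ₊ ℚ.* (pow2 m ℚ.* pow2 m)        ≡⟨ solve 1 (λ t → con (norm σ₊) :* (t :* t) := (con (ℕ→ℚ 2) :* t) :* (con (ℕ→ℚ 2) :* t)) refl (pow2 m) ⟩
    pow2 (suc m) ℚ.* pow2 (suc m)          ∎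
    where open ≡-Reasoning

  -- re (σ₊ x) = 3 re x + 5 ir x, regrouped into summands that are non-negative once re x ≥ t > 0 and ir x ≥ 0.
  re-σ₊*-dominates : ∀ x t → re (σ₊ *₅ x) ℚ.- ℕ→ℚ 2 ℚ.* t ≡ (t ℚ.+ ℕ→ℚ 3 ℚ.* (re x ℚ.- t)) ℚ.+ ℕ→ℚ 5 ℚ.* ir x
  re-σ₊*-dominates (a + b √5) t = solve 3 (λ a b t →
      con (re σ₊) :* a :+ con (ℕ→ℚ 5) :* (con (ir σ₊) :* b) :- con (ℕ→ℚ 2) :* t
    := (t :+ con (ℕ→ℚ 3) :* (a :- t)) :+ con (ℕ→ℚ 5) :* b) refl a b t

  ir-σ₊* : ∀ x t → ir (σ₊ *₅ x) ≡ ℕ→ℚ 3 ℚ.* ir x ℚ.+ ((re x ℚ.- t) ℚ.+ t)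
  ir-σ₊* (a + b √5) t = solve 3 (λ a b t → con (re σ₊) :* b :+ con (ir σ₊) :* a := con (ℕ→ℚ 3) :* b :+ ((a :- t) :+ t)) refl a b t

  norm-ι-  : ∀ t x → norm x ≡ t ℚ.* t → norm (ι t -₅ x) ≡ ℚ.- (ℕ→ℚ 2 ℚ.* t ℚ.* (re x ℚ.- t))
  norm-ι- t (a + b √5) norm-x = begin
    norm (ι t -₅ (a + b √5))
      ≡⟨ solve 4 (λ t a b s → (t :+ :- a) :* (t :+ :- a) :- s :* ((con 0ℚ :+ :- b) :* (con 0ℚ :+ :- b))
            := :- (con (ℕ→ℚ 2) :* t :* (a :- t)) :+ ((a :* a :- s :* (b :* b)) :- t :* t)) refl t a b (ℕ→ℚ 5) ⟩
    ℚ.- (ℕ→ℚ 2 ℚ.* t ℚ.* (a ℚ.- t)) ℚ.+ (norm (a + b √5) ℚ.- t ℚ.* t)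
      ≡⟨ cong (λ m → ℚ.- (ℕ→ℚ 2 ℚ.* t ℚ.* (a ℚ.- t)) ℚ.+ (m ℚ.- t ℚ.* t)) norm-x ⟩
    ℚ.- (ℕ→ℚ 2 ℚ.* t ℚ.* (a ℚ.- t)) ℚ.+ (t ℚ.* t ℚ.- t ℚ.* t)
      ≡⟨ solve 2 (λ a t → :- (con (ℕ→ℚ 2) :* t :* (a :- t)) :+ (t :* t :- t :* t) := :- (con (ℕ→ℚ 2) :* t :* (a :- t))) refl a t ⟩
    ℚ.- (ℕ→ℚ 2 ℚ.* t ℚ.* (a ℚ.- t))
      ∎
    where open ≡-Reasoning

σ₊^-step : ∀ m → NonNegative (re (σ₊ ^₅ m) ℚ.- pow2 m) × NonNegative (ir (σ₊ ^₅ m)) →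
           Positive (re (σ₊ ^₅ suc m) ℚ.- pow2 (suc m)) × NonNegative (ir (σ₊ ^₅ suc m))
σ₊^-step m (re≥ , ir≥) = subst Positive (sym (re-σ₊*-dominates x t)) re>
                       , subst NonNegative (sym (ir-σ₊* x t)) ir≥′
  where
  x : Q5
  x = σ₊ ^₅ m
  t : ℚ
  t = pow2 m
  3[re-t]≥0 : NonNegative (ℕ→ℚ 3 ℚ.* (re x ℚ.- t))
  3[re-t]≥0 = ℚP.nonNeg*nonNeg⇒nonNeg (ℕ→ℚ 3) (re x ℚ.- t) {{re≥}}
  3ir≥0 : NonNegative (ℕ→ℚ 3 ℚ.* ir x)
  3ir≥0 = ℚP.nonNeg*nonNeg⇒nonNeg (ℕ→ℚ 3) (ir x) {{ir≥}}
  5ir≥0 : NonNegative (ℕ→ℚ 5 ℚ.* ir x)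
  5ir≥0 = ℚP.nonNeg*nonNeg⇒nonNeg (ℕ→ℚ 5) (ir x) {{ir≥}}
  re> : Positive ((t ℚ.+ ℕ→ℚ 3 ℚ.* (re x ℚ.- t)) ℚ.+ ℕ→ℚ 5 ℚ.* ir x)
  re> = ℚP.pos+nonNeg⇒pos (t ℚ.+ ℕ→ℚ 3 ℚ.* (re x ℚ.- t))
          {{ℚP.pos+nonNeg⇒pos t {{pow2-positive m}} (ℕ→ℚ 3 ℚ.* (re x ℚ.- t)) {{3[re-t]≥0}}}} (ℕ→ℚ 5 ℚ.* ir x) {{5ir≥0}}
  ir≥′ : NonNegative (ℕ→ℚ 3 ℚ.* ir x ℚ.+ ((re x ℚ.- t) ℚ.+ t))
  ir≥′ = ℚP.nonNeg+nonNeg⇒nonNeg (ℕ→ℚ 3 ℚ.* ir x) {{3ir≥0}}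
          ((re x ℚ.- t) ℚ.+ t) {{ℚP.nonNeg+nonNeg⇒nonNeg (re x ℚ.- t) {{re≥}} t {{ℚP.pos⇒nonNeg t {{pow2-positive m}}}}}}

σ₊^-dominates : ∀ m → NonNegative (re (σ₊ ^₅ m) ℚ.- pow2 m) × NonNegative (ir (σ₊ ^₅ m))
σ₊^-dominates zero    = _ , _
σ₊^-dominates (suc m) = ℚP.pos⇒nonNeg (re (σ₊ ^₅ suc m) ℚ.- pow2 (suc m)) {{proj₁ next}} , proj₂ next
  where
  next : Positive (re (σ₊ ^₅ suc m) ℚ.- pow2 (suc m)) × NonNegative (ir (σ₊ ^₅ suc m))
  next = σ₊^-step m (σ₊^-dominates m)

norm-2^-σ₊^≢0 : ∀ m → norm (n₅ 2 ^₅ suc m -₅ σ₊ ^₅ suc m) ≢ 0ℚ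
norm-2^-σ₊^≢0 m norm≡0 = ℚP.<-irrefl (sym gap≡0) (ℚP.positive⁻¹ gap {{gap>0}})
  where
  t gap : ℚ
  t = pow2 (suc m)
  gap = ℕ→ℚ 2 ℚ.* t ℚ.* (re (σ₊ ^₅ suc m) ℚ.- t)
  gap>0 : Positive gap
  gap>0 = ℚP.pos*pos⇒pos (ℕ→ℚ 2 ℚ.* t) {{ℚP.pos*pos⇒pos (ℕ→ℚ 2) t {{pow2-positive (suc m)}}}}
                          (re (σ₊ ^₅ suc m) ℚ.- t) {{proj₁ (σ₊^-step m (σ₊^-dominates m))}}
  gap≡0 : gap ≡ 0ℚ
  gap≡0 = ℚP.neg-injective (begin
    ℚ.- gap                                        ≡⟨ norm-ι- t (σ₊ ^₅ suc m) (norm-σ₊^ (suc m)) ⟨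
    norm (ι t -₅ σ₊ ^₅ suc m)                    ≡⟨ cong (λ z → norm (z -₅ σ₊ ^₅ suc m)) (n₅2^≡ι-pow2 (suc m)) ⟨
    norm (n₅ 2 ^₅ suc m -₅ σ₊ ^₅ suc m)          ≡⟨ norm≡0 ⟩
    0ℚ                                           ∎)
    where open ≡-Reasoning

δ : ℕ → ℕ → ℚ
δ a b with a ℕ.≟ b
... | yes _ = 1ℚ
... | no  _ = 0ℚ

δ-≡ : ∀ {a b} → a ≡ b → δ a b ≡ 1ℚ
δ-≡ {a} {b} a≡b with a ℕ.≟ b
... | yes _   = refl
... | no  a≢b = ⊥-elim (a≢b a≡b)

δ-≢ : ∀ {a b} → a ≢ b → δ a b ≡ 0ℚ
δ-≢ {a} {b} a≢b with a ℕ.≟ b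
... | yes a≡b = ⊥-elim (a≢b a≡b)
... | no  _   = refl

δ-cong-⇔ : ∀ {a b c d} → (a ≡ b → c ≡ d) → (c ≡ d → a ≡ b) → δ a b ≡ δ c d
δ-cong-⇔ {a} {b} to from with a ℕ.≟ b
... | yes a≡b = sym (δ-≡ (to a≡b))
... | no  a≢b = sym (δ-≢ (λ c≡d → a≢b (from c≡d)))

δ-sym : ∀ a b → δ a b ≡ δ b a
δ-sym a b = δ-cong-⇔ {a} {b} {b} {a} sym sym

δ-suc : ∀ a b → δ (suc a) (suc b) ≡ δ a b
δ-suc a b = δ-cong-⇔ {suc a} {suc b} {a} {b} ℕP.suc-injective (cong suc)

I≡δ : ∀ k (a b : Fin k) → I k a b ≡ δ (toℕ a) (toℕ b)
I≡δ k a b with toℕ a ℕ.≟ toℕ b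
... | yes _ = refl
... | no  _ = refl

module _ where
  open ℚ-Solver
  open ≡-Reasoning

  sumFin-cong : ∀ {k} {f g : Fin k → ℚ} → (∀ l → f l ≡ g l) → sumFin f ≡ sumFin g
  sumFin-cong {zero}  f≗g = refl
  sumFin-cong {suc k} f≗g = cong₂ ℚ._+_ (f≗g Fin.zero) (sumFin-cong (λ l → f≗g (Fin.suc l)))

  sumFin-zero : ∀ k → sumFin {k} (λ _ → 0ℚ) ≡ 0ℚ
  sumFin-zero zero    = refl
  sumFin-zero (suc k) = cong (0ℚ ℚ.+_) (sumFin-zero k)

  sumFin-+ : ∀ {k} (f g : Fin k → ℚ) → sumFin (λ l → f l ℚ.+ g l) ≡ sumFin f ℚ.+ sumFin g
  sumFin-+ {zero}  f g = refl
  sumFin-+ {suc k} f g = begin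
    f₀ ℚ.+ g₀ ℚ.+ sumFin (λ l → f (Fin.suc l) ℚ.+ g (Fin.suc l))  ≡⟨ cong (f₀ ℚ.+ g₀ ℚ.+_) (sumFin-+ (f ∘suc) (g ∘suc)) ⟩
    f₀ ℚ.+ g₀ ℚ.+ (sumFin (f ∘suc) ℚ.+ sumFin (g ∘suc))            ≡⟨ solve 4 (λ a b c d → a :+ b :+ (c :+ d) := a :+ c :+ (b :+ d)) refl f₀ g₀ _ _ ⟩
    f₀ ℚ.+ sumFin (f ∘suc) ℚ.+ (g₀ ℚ.+ sumFin (g ∘suc))            ∎
    where
    f₀ g₀ : ℚ
    f₀ = f Fin.zero
    g₀ = g Fin.zero
    _∘suc : (Fin (suc k) → ℚ) → Fin k → ℚ
    h ∘suc = λ l → h (Fin.suc l)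

  sumFin-*ˡ : ∀ {k} c (f : Fin k → ℚ) → sumFin (λ l → c ℚ.* f l) ≡ c ℚ.* sumFin f
  sumFin-*ˡ {zero}  c f = sym (ℚP.*-zeroʳ c)
  sumFin-*ˡ {suc k} c f = trans (cong (c ℚ.* f Fin.zero ℚ.+_) (sumFin-*ˡ c (λ l → f (Fin.suc l))))
    (sym (ℚP.*-distribˡ-+ c (f Fin.zero) (sumFin (λ l → f (Fin.suc l)))))

  sumFin-neg : ∀ {k} (f : Fin k → ℚ) → sumFin (λ l → ℚ.- f l) ≡ ℚ.- sumFin f
  sumFin-neg {zero}  f = refl
  sumFin-neg {suc k} f = trans (cong (ℚ.- f Fin.zero ℚ.+_) (sumFin-neg (λ l → f (Fin.suc l))))
    (sym (ℚP.neg-distrib-+ (f Fin.zero) (sumFin (λ l → f (Fin.suc l)))))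

  sumFin-- : ∀ {k} (f g : Fin k → ℚ) → sumFin (λ l → f l ℚ.- g l) ≡ sumFin f ℚ.- sumFin g
  sumFin-- f g = trans (sumFin-+ f (λ l → ℚ.- g l)) (cong (sumFin f ℚ.+_) (sumFin-neg g))

  sumFin-swap : ∀ {k m} (F : Fin k → Fin m → ℚ) → sumFin (λ l → sumFin (F l)) ≡ sumFin (λ j → sumFin (λ l → F l j))
  sumFin-swap {zero}  {m} F = sym (sumFin-zero m)
  sumFin-swap {suc k} {m} F = begin
    sumFin (F Fin.zero) ℚ.+ sumFin (λ l → sumFin (F (Fin.suc l)))
      ≡⟨ cong (sumFin (F Fin.zero) ℚ.+_) (sumFin-swap (λ l → F (Fin.suc l))) ⟩
    sumFin (F Fin.zero) ℚ.+ sumFin (λ j → sumFin (λ l → F (Fin.suc l) j))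
      ≡⟨ sumFin-+ (F Fin.zero) (λ j → sumFin (λ l → F (Fin.suc l) j)) ⟨
    sumFin (λ j → F Fin.zero j ℚ.+ sumFin (λ l → F (Fin.suc l) j))
      ∎

  sumFin-δ : ∀ {k} (a : Fin k) (f : Fin k → ℚ) → sumFin (λ l → δ (toℕ a) (toℕ l) ℚ.* f l) ≡ f a
  sumFin-δ {suc k} Fin.zero f = begin
    δ 0 0 ℚ.* f Fin.zero ℚ.+ sumFin (λ l → δ 0 (suc (toℕ l)) ℚ.* f (Fin.suc l))
      ≡⟨ cong (1ℚ ℚ.* f Fin.zero ℚ.+_) (sumFin-cong (λ l → ℚP.*-zeroˡ (f (Fin.suc l)))) ⟩
    1ℚ ℚ.* f Fin.zero ℚ.+ sumFin {k} (λ _ → 0ℚ)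
      ≡⟨ cong₂ ℚ._+_ (ℚP.*-identityˡ (f Fin.zero)) (sumFin-zero k) ⟩
    f Fin.zero ℚ.+ 0ℚ
      ≡⟨ ℚP.+-identityʳ (f Fin.zero) ⟩
    f Fin.zero
      ∎
  sumFin-δ {suc k} (Fin.suc a) f = begin
    δ (suc (toℕ a)) 0 ℚ.* f Fin.zero ℚ.+ sumFin (λ l → δ (suc (toℕ a)) (suc (toℕ l)) ℚ.* f (Fin.suc l))
      ≡⟨ cong (0ℚ ℚ.* f Fin.zero ℚ.+_) (sumFin-cong (λ l → cong (ℚ._* f (Fin.suc l)) (δ-suc (toℕ a) (toℕ l)))) ⟩
    0ℚ ℚ.* f Fin.zero ℚ.+ sumFin (λ l → δ (toℕ a) (toℕ l) ℚ.* f (Fin.suc l))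
      ≡⟨ cong₂ ℚ._+_ (ℚP.*-zeroˡ (f Fin.zero)) (sumFin-δ a (λ l → f (Fin.suc l))) ⟩
    0ℚ ℚ.+ f (Fin.suc a)
      ≡⟨ ℚP.+-identityˡ (f (Fin.suc a)) ⟩
    f (Fin.suc a)
      ∎

sumFin-I : ∀ {k} (a : Fin k) (f : Fin k → ℚ) → sumFin (λ l → I k a l ℚ.* f l) ≡ f a
sumFin-I {k} a f = trans (sumFin-cong (λ l → cong (ℚ._* f l) (I≡δ k a l))) (sumFin-δ a f)

⊗-assoc : ∀ {k} (A B C : Matrix k) i j → ((A ⊗ B) ⊗ C) i j ≡ (A ⊗ (B ⊗ C)) i j
⊗-assoc A B C i j = begin
  sumFin (λ l → sumFin (λ m → A i m ℚ.* B m l) ℚ.* C l j)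
    ≡⟨ sumFin-cong (λ l → trans (ℚP.*-comm _ (C l j)) (sym (sumFin-*ˡ (C l j) (λ m → A i m ℚ.* B m l)))) ⟩
  sumFin (λ l → sumFin (λ m → C l j ℚ.* (A i m ℚ.* B m l)))
    ≡⟨ sumFin-swap (λ l m → C l j ℚ.* (A i m ℚ.* B m l)) ⟩
  sumFin (λ m → sumFin (λ l → C l j ℚ.* (A i m ℚ.* B m l)))
    ≡⟨ sumFin-cong (λ m → sumFin-cong (λ l → solve 3 (λ c a b → c :* (a :* b) := a :* (b :* c)) refl (C l j) (A i m) (B m l))) ⟩
  sumFin (λ m → sumFin (λ l → A i m ℚ.* (B m l ℚ.* C l j)))
    ≡⟨ sumFin-cong (λ m → sumFin-*ˡ (A i m) (λ l → B m l ℚ.* C l j)) ⟩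
  sumFin (λ m → A i m ℚ.* sumFin (λ l → B m l ℚ.* C l j))
    ∎
  where
  open ≡-Reasoning
  open ℚ-Solver

⊗-by-unit-difference : ∀ {k} (A B : Matrix k) (i i′ : Fin k) → (∀ l → A i l ≡ I k i l ℚ.- I k i′ l) →
                       ∀ j → (A ⊗ B) i j ≡ B i j ℚ.- B i′ j
⊗-by-unit-difference {k} A B i i′ A-row j = begin
  sumFin (λ l → A i l ℚ.* B l j)
    ≡⟨ sumFin-cong (λ l → trans (cong (ℚ._* B l j) (A-row l)) (solve 3 (λ a b x → (a :- b) :* x := a :* x :- b :* x) refl (I k i l) (I k i′ l) (B l j))) ⟩
  sumFin (λ l → I k i l ℚ.* B l j ℚ.- I k i′ l ℚ.* B l j)
    ≡⟨ sumFin-- (λ l → I k i l ℚ.* B l j) (λ l → I k i′ l ℚ.* B l j) ⟩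
  sumFin (λ l → I k i l ℚ.* B l j) ℚ.- sumFin (λ l → I k i′ l ℚ.* B l j)
    ≡⟨ cong₂ ℚ._-_ (sumFin-I i (λ l → B l j)) (sumFin-I i′ (λ l → B l j)) ⟩
  B i j ℚ.- B i′ j
    ∎
  where
  open ≡-Reasoning
  open ℚ-Solver

left-inverse-solves : ∀ {k} (Minv M Z W : Matrix k) → Minv ⊗ M ≡ I k → (∀ l j → (M ⊗ Z) l j ≡ W l j) →
                      ∀ i j → (Minv ⊗ W) i j ≡ Z i j
left-inverse-solves {k} Minv M Z W Minv⊗M≡I M⊗Z≡W i j = begin
  sumFin (λ l → Minv i l ℚ.* W l j)           ≡⟨ sumFin-cong (λ l → cong (Minv i l ℚ.*_) (M⊗Z≡W l j)) ⟨
  (Minv ⊗ (M ⊗ Z)) i j                         ≡⟨ ⊗-assoc Minv M Z i j ⟨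
  sumFin (λ m → (Minv ⊗ M) i m ℚ.* Z m j)     ≡⟨ sumFin-cong (λ m → cong (λ A → A i m ℚ.* Z m j) Minv⊗M≡I) ⟩
  sumFin (λ m → I k i m ℚ.* Z m j)             ≡⟨ sumFin-I i (λ m → Z m j) ⟩
  Z i j                                        ∎
  where open ≡-Reasoning

module Cyclic (h : ℕ) where
  open ≡-Reasoning

  k′ k : ℕ
  k′ = suc h
  k = suc k′

  next prev : ℕ → ℕ
  next t = suc t % k
  prev t = (t ℕ.+ k′) % k

  -- toℕ of the index at which circ k reads its coefficient in row a, column b
  offset : ℕ → ℕ → ℕ
  offset a b = (b ℕ.+ k ∸ a) % k

  next<k : ∀ t → next t < k
  next<k t = m%n<n (suc t) k

  prev<k : ∀ t → prev t < k
  prev<k t = m%n<n (t ℕ.+ k′) k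

  offset<k : ∀ a b → offset a b < k
  offset<k a b = m%n<n (b ℕ.+ k ∸ a) k

  k′%k≡k′ : k′ % k ≡ k′
  k′%k≡k′ = m<n⇒m%n≡m ℕP.≤-refl

  %-absorbˡ : ∀ m n → (m % k ℕ.+ n) % k ≡ (m ℕ.+ n) % k
  %-absorbˡ m n = begin
    (m % k ℕ.+ n) % k            ≡⟨ %-distribˡ-+ (m % k) n k ⟩
    (m % k % k ℕ.+ n % k) % k    ≡⟨ cong (λ x → (x ℕ.+ n % k) % k) (m%n%n≡m%n m k) ⟩
    (m % k ℕ.+ n % k) % k        ≡⟨ %-distribˡ-+ m n k ⟨
    (m ℕ.+ n) % k                ∎

  %-absorbʳ : ∀ m n → (m ℕ.+ n % k) % k ≡ (m ℕ.+ n) % k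
  %-absorbʳ m n = begin
    (m ℕ.+ n % k) % k            ≡⟨ cong (_% k) (ℕP.+-comm m (n % k)) ⟩
    (n % k ℕ.+ m) % k            ≡⟨ %-absorbˡ n m ⟩
    (n ℕ.+ m) % k                ≡⟨ cong (_% k) (ℕP.+-comm n m) ⟩
    (m ℕ.+ n) % k                ∎

  +k%k≡ : ∀ t → t < k → (t ℕ.+ k) % k ≡ t
  +k%k≡ t t<k = trans ([m+n]%n≡m%n t k) (m<n⇒m%n≡m t<k)

  prev-next : ∀ t → t < k → prev (next t) ≡ t
  prev-next t t<k = begin
    (suc t % k ℕ.+ k′) % k    ≡⟨ %-absorbˡ (suc t) k′ ⟩
    (suc t ℕ.+ k′) % k        ≡⟨ cong (_% k) (ℕP.+-suc t k′) ⟨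
    (t ℕ.+ k) % k             ≡⟨ +k%k≡ t t<k ⟩
    t                         ∎

  next-prev : ∀ t → t < k → next (prev t) ≡ t
  next-prev t t<k = begin
    suc ((t ℕ.+ k′) % k) % k    ≡⟨ %-absorbʳ 1 (t ℕ.+ k′) ⟩
    suc (t ℕ.+ k′) % k          ≡⟨ cong (_% k) (ℕP.+-suc t k′) ⟨
    (t ℕ.+ k) % k               ≡⟨ +k%k≡ t t<k ⟩
    t                           ∎

  offset-prev : ∀ a b → a < k → offset (prev a) b ≡ next (offset a b)
  offset-prev zero b _ = begin
    (b ℕ.+ k ∸ k′ % k) % k       ≡⟨ cong (λ x → (b ℕ.+ k ∸ x) % k) k′%k≡k′ ⟩
    (b ℕ.+ k ∸ k′) % k           ≡⟨ cong (λ x → (x ∸ k′) % k) (ℕP.+-suc b k′) ⟩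
    (suc b ℕ.+ k′ ∸ k′) % k      ≡⟨ cong (_% k) (ℕP.m+n∸n≡m (suc b) k′) ⟩
    suc b % k                    ≡⟨ [m+n]%n≡m%n (suc b) k ⟨
    suc (b ℕ.+ k) % k            ≡⟨ %-absorbʳ 1 (b ℕ.+ k) ⟨
    next (offset zero b)         ∎
  offset-prev (suc a) b a<k = begin
    (b ℕ.+ k ∸ prev (suc a)) % k        ≡⟨ cong (λ x → (b ℕ.+ k ∸ x) % k) prev-suc ⟩
    (b ℕ.+ k ∸ a) % k                   ≡⟨ cong (_% k) (ℕP.+-∸-assoc b (ℕP.<⇒≤ (ℕP.<-trans (ℕP.n<1+n a) a<k))) ⟩
    (b ℕ.+ (k ∸ a)) % k                 ≡⟨ cong (λ x → (b ℕ.+ x) % k) (ℕP.+-∸-assoc 1 (ℕP.<⇒≤ a<k)) ⟩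
    (b ℕ.+ suc (k ∸ suc a)) % k         ≡⟨ cong (_% k) (ℕP.+-suc b (k ∸ suc a)) ⟩
    suc (b ℕ.+ (k ∸ suc a)) % k         ≡⟨ cong (λ x → suc x % k) (ℕP.+-∸-assoc b (ℕP.<⇒≤ a<k)) ⟨
    suc (b ℕ.+ k ∸ suc a) % k           ≡⟨ %-absorbʳ 1 (b ℕ.+ k ∸ suc a) ⟨
    next (offset (suc a) b)             ∎
    where
    prev-suc : prev (suc a) ≡ a
    prev-suc = trans (cong (_% k) (sym (ℕP.+-suc a k′))) (+k%k≡ a (ℕP.<-trans (ℕP.n<1+n a) a<k))

  offset-next : ∀ a b → a < k → offset (next a) b ≡ prev (offset a b)
  offset-next a b a<k = begin
    offset (next a) b                      ≡⟨ prev-next (offset (next a) b) (offset<k (next a) b) ⟨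
    prev (next (offset (next a) b))        ≡⟨ cong prev (offset-prev (next a) b (next<k a)) ⟨
    prev (offset (prev (next a)) b)        ≡⟨ cong (λ x → prev (offset x b)) (prev-next a a<k) ⟩
    prev (offset a b)                      ∎

  offset-self : ∀ a → offset a a ≡ 0
  offset-self a = trans (cong (_% k) (ℕP.m+n∸m≡n a k)) (n%n≡0 k)

  +offset : ∀ a b → a < k → b < k → (a ℕ.+ offset a b) % k ≡ b
  +offset a b a<k b<k = begin
    (a ℕ.+ (b ℕ.+ k ∸ a) % k) % k     ≡⟨ %-absorbʳ a (b ℕ.+ k ∸ a) ⟩
    (a ℕ.+ (b ℕ.+ k ∸ a)) % k         ≡⟨ cong (_% k) (ℕP.m+[n∸m]≡n (ℕP.≤-trans (ℕP.<⇒≤ a<k) (ℕP.m≤n+m k b))) ⟩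
    (b ℕ.+ k) % k                     ≡⟨ +k%k≡ b b<k ⟩
    b                                 ∎

  offset≡0⇒≡ : ∀ a b → a < k → b < k → offset a b ≡ 0 → a ≡ b
  offset≡0⇒≡ a b a<k b<k offset≡0 = begin
    a                             ≡⟨ m<n⇒m%n≡m a<k ⟨
    a % k                         ≡⟨ cong (_% k) (ℕP.+-identityʳ a) ⟨
    (a ℕ.+ 0) % k                 ≡⟨ cong (λ t → (a ℕ.+ t) % k) offset≡0 ⟨
    (a ℕ.+ offset a b) % k        ≡⟨ +offset a b a<k b<k ⟩
    b                             ∎

  δ-offset : ∀ a b → a < k → b < k → δ a b ≡ δ (offset a b) 0
  δ-offset a b a<k b<k = δ-cong-⇔ {a} {b} {offset a b} {0}
    (λ a≡b → trans (cong (offset a) (sym a≡b)) (offset-self a))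
    (offset≡0⇒≡ a b a<k b<k)

  δ-prev : ∀ a b → a < k → b < k → δ (prev a) b ≡ δ a (next b)
  δ-prev a b a<k b<k = δ-cong-⇔ {prev a} {b} {a} {next b}
    (λ prev-a≡b → trans (sym (next-prev a a<k)) (cong next prev-a≡b))
    (λ a≡next-b → trans (cong prev a≡next-b) (prev-next b b<k))

  δ-next-0 : ∀ t → t < k → δ (next t) 0 ≡ δ t k′
  δ-next-0 t t<k = δ-cong-⇔ {next t} {0} {t} {k′}
    (λ next-t≡0 → trans (sym (prev-next t t<k)) (trans (cong prev next-t≡0) k′%k≡k′))
    (λ t≡k′ → trans (cong next t≡k′) (n%n≡0 k))

module Shift (h : ℕ) where
  open Cyclic h public
  open ≡-Reasoning

  rot⁺ rot⁻ : Fin k → Fin k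
  rot⁺ i = fromℕ< (next<k (toℕ i))
  rot⁻ i = fromℕ< (prev<k (toℕ i))

  rot⁻-rot⁺ : ∀ i → rot⁻ (rot⁺ i) ≡ i
  rot⁻-rot⁺ i = toℕ-injective (begin
    toℕ (rot⁻ (rot⁺ i))      ≡⟨ toℕ-fromℕ< (prev<k (toℕ (rot⁺ i))) ⟩
    prev (toℕ (rot⁺ i))      ≡⟨ cong prev (toℕ-fromℕ< (next<k (toℕ i))) ⟩
    prev (next (toℕ i))      ≡⟨ prev-next (toℕ i) (toℕ<n i) ⟩
    toℕ i                    ∎)

  I-rot⁺ : ∀ i l → I k (rot⁺ i) l ≡ δ (next (toℕ i)) (toℕ l)
  I-rot⁺ i l = trans (I≡δ k (rot⁺ i) l) (cong (λ a → δ a (toℕ l)) (toℕ-fromℕ< (next<k (toℕ i))))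

  I-rot⁻ : ∀ i l → I k (rot⁻ i) l ≡ δ (prev (toℕ i)) (toℕ l)
  I-rot⁻ i l = trans (I≡δ k (rot⁻ i) l) (cong (λ a → δ a (toℕ l)) (toℕ-fromℕ< (prev<k (toℕ i))))

  I≡δ-offset : ∀ i l → I k i l ≡ δ (offset (toℕ i) (toℕ l)) 0
  I≡δ-offset i l = trans (I≡δ k i l) (δ-offset (toℕ i) (toℕ l) (toℕ<n i) (toℕ<n l))

  cC-0 : ∀ x → toℕ x ≡ 0 → cC k x ≡ 1ℚ
  cC-0 x x≡0 with toℕ x ℕ.≟ 0
  ... | yes _   = refl
  ... | no  x≢0 = ⊥-elim (x≢0 x≡0)

  cC-k′ : ∀ x → toℕ x ≡ k′ → cC k x ≡ ℚ.- 1ℚ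
  cC-k′ x x≡k′ with toℕ x ℕ.≟ 0
  ... | yes x≡0 = ⊥-elim (ℕP.0≢1+n (trans (sym x≡0) x≡k′))
  ... | no  _ with toℕ x ℕ.≟ k′
  ...   | yes _    = refl
  ...   | no  x≢k′ = ⊥-elim (x≢k′ x≡k′)

  cC-other : ∀ x → toℕ x ≢ 0 → toℕ x ≢ k′ → cC k x ≡ 0ℚ
  cC-other x x≢0 x≢k′ with toℕ x ℕ.≟ 0
  ... | yes x≡0 = ⊥-elim (x≢0 x≡0)
  ... | no  _ with toℕ x ℕ.≟ k′
  ...   | yes x≡k′ = ⊥-elim (x≢k′ x≡k′)
  ...   | no  _    = refl

  cC≡δ-δ : ∀ x → cC k x ≡ δ (toℕ x) 0 ℚ.- δ (toℕ x) k′
  cC≡δ-δ x = cases (toℕ x ℕ.≟ 0) (toℕ x ℕ.≟ k′)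
    where
    cases : Dec (toℕ x ≡ 0) → Dec (toℕ x ≡ k′) → cC k x ≡ δ (toℕ x) 0 ℚ.- δ (toℕ x) k′
    cases (yes x≡0) _ = trans (cC-0 x x≡0) (sym (cong₂ ℚ._-_ (δ-≡ x≡0) (δ-≢ (λ x≡k′ → ℕP.0≢1+n (trans (sym x≡0) x≡k′)))))
    cases (no x≢0) (yes x≡k′) = trans (cC-k′ x x≡k′) (sym (cong₂ ℚ._-_ (δ-≢ x≢0) (δ-≡ x≡k′)))
    cases (no x≢0) (no x≢k′) = trans (cC-other x x≢0 x≢k′) (sym (cong₂ ℚ._-_ (δ-≢ x≢0) (δ-≢ x≢k′)))

  C-row : ∀ i l → Cmat k i l ≡ I k i l ℚ.- I k (rot⁻ i) l
  C-row i l = begin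
    cC k ((toℕ l ℕ.+ k ∸ toℕ i) mod k)   ≡⟨ cC≡δ-δ ((toℕ l ℕ.+ k ∸ toℕ i) mod k) ⟩
    δ x 0 ℚ.- δ x k′                      ≡⟨ cong (λ t → δ t 0 ℚ.- δ t k′) (toℕ-fromℕ< (offset<k (toℕ i) (toℕ l))) ⟩
    δ t 0 ℚ.- δ t k′                      ≡⟨ cong (λ z → δ t 0 ℚ.- z) (δ-next-0 t (offset<k (toℕ i) (toℕ l))) ⟨
    δ t 0 ℚ.- δ (next t) 0                ≡⟨ cong (λ s → δ t 0 ℚ.- δ s 0) (offset-prev (toℕ i) (toℕ l) (toℕ<n i)) ⟨
    δ t 0 ℚ.- δ (offset (prev (toℕ i)) (toℕ l)) 0
      ≡⟨ cong (λ z → δ t 0 ℚ.- z) (δ-offset (prev (toℕ i)) (toℕ l) (prev<k (toℕ i)) (toℕ<n l)) ⟨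
    δ t 0 ℚ.- δ (prev (toℕ i)) (toℕ l)    ≡⟨ cong₂ ℚ._-_ (I≡δ-offset i l) (I-rot⁻ i l) ⟨
    I k i l ℚ.- I k (rot⁻ i) l            ∎
    where
    x t : ℕ
    x = toℕ ((toℕ l ℕ.+ k ∸ toℕ i) mod k)
    t = offset (toℕ i) (toℕ l)

  Cᵀ-row : ∀ i l → Cmat k l i ≡ I k i l ℚ.- I k (rot⁺ i) l
  Cᵀ-row i l = begin
    Cmat k l i                                        ≡⟨ C-row l i ⟩
    I k l i ℚ.- I k (rot⁻ l) i                        ≡⟨ cong₂ ℚ._-_ (I≡δ k l i) (I-rot⁻ l i) ⟩
    δ (toℕ l) (toℕ i) ℚ.- δ (prev (toℕ l)) (toℕ i)   ≡⟨ cong₂ ℚ._-_ (δ-sym (toℕ l) (toℕ i)) (δ-prev (toℕ l) (toℕ i) (toℕ<n l) (toℕ<n i)) ⟩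
    δ (toℕ i) (toℕ l) ℚ.- δ (toℕ l) (next (toℕ i))   ≡⟨ cong (λ z → δ (toℕ i) (toℕ l) ℚ.- z) (δ-sym (toℕ l) (next (toℕ i))) ⟩
    δ (toℕ i) (toℕ l) ℚ.- δ (next (toℕ i)) (toℕ l)   ≡⟨ cong₂ ℚ._-_ (I≡δ k i l) (I-rot⁺ i l) ⟨
    I k i l ℚ.- I k (rot⁺ i) l                        ∎

  C⊗ : ∀ (A : Matrix k) i j → (Cmat k ⊗ A) i j ≡ A i j ℚ.- A (rot⁻ i) j
  C⊗ A i = ⊗-by-unit-difference (Cmat k) A i (rot⁻ i) (C-row i)

  Cᵀ⊗ : ∀ (A : Matrix k) i j → (transpose (Cmat k) ⊗ A) i j ≡ A i j ℚ.- A (rot⁺ i) j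
  Cᵀ⊗ A i = ⊗-by-unit-difference (transpose (Cmat k)) A i (rot⁺ i) (Cᵀ-row i)

  module CirculantSolution (n : ℕ) (e : ℕ → ℚ)
    (e-rec : ∀ t → t < k → ℕ→ℚ 3 ℚ.* e t ℚ.- e (next t) ℚ.- e (prev t) ≡ ℕ→ℚ n ℚ.* (δ t 0 ℚ.- δ t 1)) where

    C W D Z M : Matrix k
    C = Cmat k
    W = J k ⊖ (ℕ→ℚ n · I k)
    D i j = e (offset (toℕ i) (toℕ j))
    M = (C ⊗ transpose C) ⊕ I k
    Z = W ⊕ (C ⊗ D)

    D-rec : ∀ i j → ℕ→ℚ 3 ℚ.* D i j ℚ.- D (rot⁻ i) j ℚ.- D (rot⁺ i) j ≡ ℕ→ℚ n ℚ.* (I k i j ℚ.- I k (rot⁺ i) j)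
    D-rec i j = begin
      ℕ→ℚ 3 ℚ.* e t ℚ.- e (offset (toℕ (rot⁻ i)) (toℕ j)) ℚ.- e (offset (toℕ (rot⁺ i)) (toℕ j))
        ≡⟨ cong₂ (λ a b → ℕ→ℚ 3 ℚ.* e t ℚ.- e a ℚ.- e b) offset-rot⁻ offset-rot⁺ ⟩
      ℕ→ℚ 3 ℚ.* e t ℚ.- e (next t) ℚ.- e (prev t)
        ≡⟨ e-rec t (offset<k (toℕ i) (toℕ j)) ⟩
      ℕ→ℚ n ℚ.* (δ t 0 ℚ.- δ t 1)
        ≡⟨ cong (λ z → ℕ→ℚ n ℚ.* (δ t 0 ℚ.- z)) (δ-prev t 0 (offset<k (toℕ i) (toℕ j)) (s≤s z≤n)) ⟨
      ℕ→ℚ n ℚ.* (δ t 0 ℚ.- δ (prev t) 0)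
        ≡⟨ cong (λ s → ℕ→ℚ n ℚ.* (δ t 0 ℚ.- δ s 0)) offset-rot⁺ ⟨
      ℕ→ℚ n ℚ.* (δ t 0 ℚ.- δ (offset (toℕ (rot⁺ i)) (toℕ j)) 0)
        ≡⟨ cong₂ (λ a b → ℕ→ℚ n ℚ.* (a ℚ.- b)) (I≡δ-offset i j) (I≡δ-offset (rot⁺ i) j) ⟨
      ℕ→ℚ n ℚ.* (I k i j ℚ.- I k (rot⁺ i) j)
        ∎
      where
      t : ℕ
      t = offset (toℕ i) (toℕ j)
      offset-rot⁻ : offset (toℕ (rot⁻ i)) (toℕ j) ≡ next t
      offset-rot⁻ = trans (cong (λ a → offset a (toℕ j)) (toℕ-fromℕ< (prev<k (toℕ i)))) (offset-prev (toℕ i) (toℕ j) (toℕ<n i))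
      offset-rot⁺ : offset (toℕ (rot⁺ i)) (toℕ j) ≡ prev t
      offset-rot⁺ = trans (cong (λ a → offset a (toℕ j)) (toℕ-fromℕ< (next<k (toℕ i)))) (offset-next (toℕ i) (toℕ j) (toℕ<n i))

    Cᵀ⊗Z : ∀ i j → (transpose C ⊗ Z) i j ≡ ℚ.- D i j
    Cᵀ⊗Z i j = begin
      (transpose C ⊗ Z) i j
        ≡⟨ Cᵀ⊗ Z i j ⟩
      Z i j ℚ.- Z (rot⁺ i) j
        ≡⟨ cong₂ (λ a b → (W i j ℚ.+ a) ℚ.- (W (rot⁺ i) j ℚ.+ b)) (C⊗ D i j) (trans (C⊗ D (rot⁺ i) j) (cong (λ z → D (rot⁺ i) j ℚ.- D z j) (rot⁻-rot⁺ i))) ⟩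
      (W i j ℚ.+ (D i j ℚ.- D (rot⁻ i) j)) ℚ.- (W (rot⁺ i) j ℚ.+ (D (rot⁺ i) j ℚ.- D i j))
        ≡⟨ solve 6 (λ d d⁻ d⁺ n a b → ((con 1ℚ :- n :* a) :+ (d :- d⁻)) :- ((con 1ℚ :- n :* b) :+ (d⁺ :- d))
              := :- d :+ ((con (ℕ→ℚ 3) :* d :- d⁻ :- d⁺) :- n :* (a :- b))) refl (D i j) (D (rot⁻ i) j) (D (rot⁺ i) j) (ℕ→ℚ n) (I k i j) (I k (rot⁺ i) j) ⟩
      ℚ.- D i j ℚ.+ ((ℕ→ℚ 3 ℚ.* D i j ℚ.- D (rot⁻ i) j ℚ.- D (rot⁺ i) j) ℚ.- ℕ→ℚ n ℚ.* (I k i j ℚ.- I k (rot⁺ i) j))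
        ≡⟨ cong (λ z → ℚ.- D i j ℚ.+ (z ℚ.- ℕ→ℚ n ℚ.* (I k i j ℚ.- I k (rot⁺ i) j))) (D-rec i j) ⟩
      ℚ.- D i j ℚ.+ (ℕ→ℚ n ℚ.* (I k i j ℚ.- I k (rot⁺ i) j) ℚ.- ℕ→ℚ n ℚ.* (I k i j ℚ.- I k (rot⁺ i) j))
        ≡⟨ solve 2 (λ d x → :- d :+ (x :- x) := :- d) refl (D i j) (ℕ→ℚ n ℚ.* (I k i j ℚ.- I k (rot⁺ i) j)) ⟩
      ℚ.- D i j
        ∎
      where open ℚ-Solver

    M⊗Z : ∀ l j → (M ⊗ Z) l j ≡ W l j
    M⊗Z l j = begin
      sumFin (λ m → ((C ⊗ transpose C) l m ℚ.+ I k l m) ℚ.* Z m j)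
        ≡⟨ sumFin-cong (λ m → ℚP.*-distribʳ-+ (Z m j) ((C ⊗ transpose C) l m) (I k l m)) ⟩
      sumFin (λ m → (C ⊗ transpose C) l m ℚ.* Z m j ℚ.+ I k l m ℚ.* Z m j)
        ≡⟨ sumFin-+ (λ m → (C ⊗ transpose C) l m ℚ.* Z m j) (λ m → I k l m ℚ.* Z m j) ⟩
      ((C ⊗ transpose C) ⊗ Z) l j ℚ.+ sumFin (λ m → I k l m ℚ.* Z m j)
        ≡⟨ cong₂ ℚ._+_ (⊗-assoc C (transpose C) Z l j) (sumFin-I l (λ m → Z m j)) ⟩
      sumFin (λ m → C l m ℚ.* (transpose C ⊗ Z) m j) ℚ.+ Z l j
        ≡⟨ cong (ℚ._+ Z l j) (sumFin-cong (λ m → trans (cong (C l m ℚ.*_) (Cᵀ⊗Z m j)) (sym (ℚP.neg-distribʳ-* (C l m) (D m j))))) ⟩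
      sumFin (λ m → ℚ.- (C l m ℚ.* D m j)) ℚ.+ (W l j ℚ.+ (C ⊗ D) l j)
        ≡⟨ cong (ℚ._+ (W l j ℚ.+ (C ⊗ D) l j)) (sumFin-neg (λ m → C l m ℚ.* D m j)) ⟩
      ℚ.- (C ⊗ D) l j ℚ.+ (W l j ℚ.+ (C ⊗ D) l j)
        ≡⟨ solve 2 (λ x w → :- x :+ (w :+ x) := w) refl ((C ⊗ D) l j) (W l j) ⟩
      W l j
        ∎
      where open ℚ-Solver

    Y≡D : (Minv : Matrix k) → Minv ⊗ M ≡ I k → ∀ i j → neg (transpose C ⊗ (Minv ⊗ W)) i j ≡ D i j
    Y≡D Minv Minv⊗M≡I i j = begin
      ℚ.- sumFin (λ l → C l i ℚ.* (Minv ⊗ W) l j)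
        ≡⟨ cong ℚ.-_ (sumFin-cong (λ l → cong (C l i ℚ.*_) (left-inverse-solves Minv M Z W Minv⊗M≡I M⊗Z l j))) ⟩
      ℚ.- (transpose C ⊗ Z) i j
        ≡⟨ cong ℚ.-_ (Cᵀ⊗Z i j) ⟩
      ℚ.- (ℚ.- D i j)
        ≡⟨ solve 1 (λ d → :- (:- d) := d) refl (D i j) ⟩
      D i j
        ∎
      where open ℚ-Solver

-- σ₊ = 2α and σ₋ = 2β hold by computation.
σ₋ α β ω √5⁻¹ : Q5
σ₋ = n₅ 3 -₅ √5
α = (+ 3 / 2) + (+ 1 / 2) √5
β = conj α
ω = inv₅ (n₅ 5 +₅ √5)
√5⁻¹ = inv₅ √5

conj-ω : conj ω ≡ ω *₅ α
conj-ω = refl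

module ClosedForm (r : ℕ) where
  open Q5-Solver
  open ≡-Reasoning

  k n : ℕ
  k = suc r
  n = suc k

  N T Dα Dβ u v c : Q5
  N = n₅ n
  T = n₅ 2 ^₅ k
  Dα = T -₅ σ₊ ^₅ k
  Dβ = T -₅ σ₋ ^₅ k
  u = inv₅ Dα
  v = inv₅ Dβ
  c = -₅ (N *₅ ω *₅ (n₅ 2 *₅ T))

  f : ℕ → Q5
  f j = c *₅ (α ^₅ suc j *₅ u +₅ β ^₅ j *₅ v)

  f-rec : ∀ j → f (suc (suc j)) ≡ n₅ 3 *₅ f (suc j) -₅ f j
  f-rec j = solve 5 (λ c X Y U V →
       c :* (con α :* (con α :* (con α :* X)) :* U :+ con β :* (con β :* Y) :* V)
    := con (n₅ 3) :* (c :* (con α :* (con α :* X) :* U :+ con β :* Y :* V)) :- c :* (con α :* X :* U :+ Y :* V))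
    refl c (α ^₅ j) (β ^₅ j) u v

  conj-Dα : conj Dα ≡ Dβ
  conj-Dα = trans (conj--₅ T (σ₊ ^₅ k)) (cong₂ _-₅_ (conj-^₅ (n₅ 2) k) (conj-^₅ σ₊ k))

  conj-Dβ : conj Dβ ≡ Dα
  conj-Dβ = trans (conj--₅ T (σ₋ ^₅ k)) (cong₂ _-₅_ (conj-^₅ (n₅ 2) k) (conj-^₅ σ₋ k))

  Dα*u : (T -₅ T *₅ α ^₅ k) *₅ u ≡ ι 1ℚ
  Dα*u = begin
    (T -₅ T *₅ α ^₅ k) *₅ u   ≡⟨ cong (λ z → (T -₅ z) *₅ u) (^₅-distrib-*₅ (n₅ 2) α k) ⟨
    Dα *₅ u                   ≡⟨ inv₅-inverseʳ Dα (norm-2^-σ₊^≢0 r) ⟩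
    ι 1ℚ                      ∎

  Dβ*v : (T -₅ T *₅ β ^₅ k) *₅ v ≡ ι 1ℚ
  Dβ*v = begin
    (T -₅ T *₅ β ^₅ k) *₅ v   ≡⟨ cong (λ z → (T -₅ z) *₅ v) (^₅-distrib-*₅ (n₅ 2) β k) ⟨
    Dβ *₅ v                   ≡⟨ inv₅-inverseʳ Dβ norm-Dβ≢0 ⟩
    ι 1ℚ                      ∎
    where
    norm-Dβ≢0 : norm Dβ ≢ 0ℚ
    norm-Dβ≢0 norm≡0 = norm-2^-σ₊^≢0 r (trans (sym (norm-conj Dα)) (trans (cong norm conj-Dα) norm≡0))

  f-wrap : f k -₅ f 0 ≡ N
  f-wrap = begin
    f k -₅ f 0
      ≡⟨ solve 6 (λ N′ T′ X Y U V →
           (:- (N′ :* con ω :* (con (n₅ 2) :* T′))) :* (con α :* X :* U :+ Y :* V)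
           :- (:- (N′ :* con ω :* (con (n₅ 2) :* T′))) :* (con α :* con (ι 1ℚ) :* U :+ con (ι 1ℚ) :* V)
           := N′ :* con ω :* con (n₅ 2) :* (con α :* ((T′ :- T′ :* X) :* U) :+ (T′ :- T′ :* Y) :* V))
           refl N T (α ^₅ k) (β ^₅ k) u v ⟩
    N *₅ ω *₅ n₅ 2 *₅ (α *₅ ((T -₅ T *₅ α ^₅ k) *₅ u) +₅ (T -₅ T *₅ β ^₅ k) *₅ v)
      ≡⟨ cong₂ (λ a b → N *₅ ω *₅ n₅ 2 *₅ (α *₅ a +₅ b)) Dα*u Dβ*v ⟩
    N *₅ ω *₅ n₅ 2 *₅ (α *₅ ι 1ℚ +₅ ι 1ℚ)
      ≡⟨ solve 1 (λ N′ → N′ :* con ω :* con (n₅ 2) :* (con α :* con (ι 1ℚ) :+ con (ι 1ℚ)) := N′) refl N ⟩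
    N ∎

  f-wrap′ : n₅ 3 *₅ f 0 -₅ f r -₅ f 1 ≡ -₅ N
  f-wrap′ = begin
    n₅ 3 *₅ f 0 -₅ f r -₅ f 1
      ≡⟨ solve 6 (λ N′ T′ X Y U V →
           con (n₅ 3) :* ((:- (N′ :* con ω :* (con (n₅ 2) :* T′))) :* (con α :* con (ι 1ℚ) :* U :+ con (ι 1ℚ) :* V))
           :- (:- (N′ :* con ω :* (con (n₅ 2) :* T′))) :* (con α :* X :* U :+ Y :* V)
           :- (:- (N′ :* con ω :* (con (n₅ 2) :* T′))) :* (con α :* (con α :* con (ι 1ℚ)) :* U :+ con β :* con (ι 1ℚ) :* V)
           := :- (N′ :* con ω :* con (n₅ 2) :* ((T′ :- T′ :* (con α :* X)) :* U :+ con α :* ((T′ :- T′ :* (con β :* Y)) :* V))))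
           refl N T (α ^₅ r) (β ^₅ r) u v ⟩
    -₅ (N *₅ ω *₅ n₅ 2 *₅ ((T -₅ T *₅ α ^₅ k) *₅ u +₅ α *₅ ((T -₅ T *₅ β ^₅ k) *₅ v)))
      ≡⟨ cong₂ (λ a b → -₅ (N *₅ ω *₅ n₅ 2 *₅ (a +₅ α *₅ b))) Dα*u Dβ*v ⟩
    -₅ (N *₅ ω *₅ n₅ 2 *₅ (ι 1ℚ +₅ α *₅ ι 1ℚ))
      ≡⟨ solve 1 (λ N′ → :- (N′ :* con ω :* con (n₅ 2) :* (con (ι 1ℚ) :+ con α :* con (ι 1ℚ))) := :- N′) refl N ⟩
    -₅ N ∎

  d₀≡f : d₀ n ≡ f r
  d₀≡f = begin
    d₀ n
      ≡⟨ cong₂ (λ x y → (n₅ 2 *₅ N) *₅ √5⁻¹ *₅ ((x -₅ R) *₅ u -₅ (y -₅ R) *₅ v)) (^₅-distrib-*₅ (n₅ 2) α r) (^₅-distrib-*₅ (n₅ 2) β r) ⟩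
    (n₅ 2 *₅ N) *₅ √5⁻¹ *₅ ((R *₅ X -₅ R) *₅ u -₅ (R *₅ Y -₅ R) *₅ v)
      ≡⟨ solve 6 (λ N′ R′ X′ Y′ U V →
           (con (n₅ 2) :* N′) :* con √5⁻¹ :* ((R′ :* X′ :- R′) :* U :- (R′ :* Y′ :- R′) :* V)
           := (:- (N′ :* con ω :* (con (n₅ 2) :* (con (n₅ 2) :* R′)))) :* (con α :* X′ :* U :+ Y′ :* V)
              :+ (con (n₅ 2) :* N′ :* R′) :* ((con √5⁻¹ :* (X′ :- con (ι 1ℚ)) :+ con (n₅ 2) :* con ω :* con α :* X′) :* U
                    :+ (:- (con √5⁻¹ :* (Y′ :- con (ι 1ℚ))) :+ con (n₅ 2) :* con ω :* Y′) :* V))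
           refl N R X Y u v ⟩
    f r +₅ (n₅ 2 *₅ N *₅ R) *₅ (a *₅ u +₅ b *₅ v)
      ≡⟨ cong (λ z → f r +₅ (n₅ 2 *₅ N *₅ R) *₅ z) au+bv≡0 ⟩
    f r +₅ (n₅ 2 *₅ N *₅ R) *₅ ι 0ℚ
      ≡⟨ solve 2 (λ F P → F :+ P :* con (ι 0ℚ) := F) refl (f r) (n₅ 2 *₅ N *₅ R) ⟩
    f r ∎
    where
    R X Y a b : Q5
    R = n₅ 2 ^₅ r
    X = α ^₅ r
    Y = β ^₅ r
    a = √5⁻¹ *₅ (X -₅ ι 1ℚ) +₅ n₅ 2 *₅ ω *₅ α *₅ X
    b = -₅ (√5⁻¹ *₅ (Y -₅ ι 1ℚ)) +₅ n₅ 2 *₅ ω *₅ Y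
    cross-term : a *₅ (T -₅ T *₅ β ^₅ k) +₅ b *₅ (T -₅ T *₅ α ^₅ k) ≡ ι 0ℚ
    cross-term = solve 3 (λ R′ X′ Y′ →
         (con √5⁻¹ :* (X′ :- con (ι 1ℚ)) :+ con (n₅ 2) :* con ω :* con α :* X′) :* (con (n₅ 2) :* R′ :- con (n₅ 2) :* R′ :* (con β :* Y′))
      :+ (:- (con √5⁻¹ :* (Y′ :- con (ι 1ℚ))) :+ con (n₅ 2) :* con ω :* Y′) :* (con (n₅ 2) :* R′ :- con (n₅ 2) :* R′ :* (con α :* X′))
      := con (ι 0ℚ)) refl R X Y
    au+bv≡0 : a *₅ u +₅ b *₅ v ≡ ι 0ℚ
    au+bv≡0 = begin
      a *₅ u +₅ b *₅ v
        ≡⟨ solve 4 (λ A B U V → A :* U :+ B :* V := A :* U :* con (ι 1ℚ) :+ B :* V :* con (ι 1ℚ)) refl a b u v ⟩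
      a *₅ u *₅ ι 1ℚ +₅ b *₅ v *₅ ι 1ℚ
        ≡⟨ cong₂ (λ x y → a *₅ u *₅ x +₅ b *₅ v *₅ y) Dβ*v Dα*u ⟨
      a *₅ u *₅ ((T -₅ T *₅ β ^₅ k) *₅ v) +₅ b *₅ v *₅ ((T -₅ T *₅ α ^₅ k) *₅ u)
        ≡⟨ solve 6 (λ A B U V P Q → A :* U :* (P :* V) :+ B :* V :* (Q :* U) := (A :* P :+ B :* Q) :* (U :* V))
             refl a b u v (T -₅ T *₅ β ^₅ k) (T -₅ T *₅ α ^₅ k) ⟩
      (a *₅ (T -₅ T *₅ β ^₅ k) +₅ b *₅ (T -₅ T *₅ α ^₅ k)) *₅ (u *₅ v)
        ≡⟨ cong (_*₅ (u *₅ v)) cross-term ⟩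
      ι 0ℚ *₅ (u *₅ v)
        ≡⟨ solve 1 (λ W → con (ι 0ℚ) :* W := con (ι 0ℚ)) refl (u *₅ v) ⟩
      ι 0ℚ ∎

  dⱼ≡f : ∀ i → suc i ≤ n → dⱼ n (suc i) ≡ f i
  dⱼ≡f i i<n = begin
    dⱼ n (suc i)
      ≡⟨ cong₂ (λ x y → -₅ ((N *₅ E) *₅ ω) *₅ (x *₅ u +₅ (n₅ 2 *₅ y) *₅ v)) (^₅-distrib-*₅ (n₅ 2) α (suc i)) (^₅-distrib-*₅ (n₅ 2) β i) ⟩
    -₅ ((N *₅ E) *₅ ω) *₅ ((n₅ 2 *₅ Z) *₅ (α *₅ X) *₅ u +₅ (n₅ 2 *₅ (Z *₅ Y)) *₅ v)
      ≡⟨ solve 7 (λ N′ E′ Z′ X′ Y′ U V →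
           :- ((N′ :* E′) :* con ω) :* ((con (n₅ 2) :* Z′) :* (con α :* X′) :* U :+ (con (n₅ 2) :* (Z′ :* Y′)) :* V)
           := :- (N′ :* con ω :* (E′ :* (con (n₅ 2) :* Z′))) :* (con α :* X′ :* U :+ Y′ :* V))
           refl N E Z X Y u v ⟩
    -₅ (N *₅ ω *₅ (E *₅ (n₅ 2 *₅ Z))) *₅ (α *₅ X *₅ u +₅ Y *₅ v)
      ≡⟨ cong (λ z → -₅ (N *₅ ω *₅ z) *₅ (α *₅ X *₅ u +₅ Y *₅ v)) 2^[n-j]*2^j≡2^n ⟩
    f i ∎
    where
    E Z X Y : Q5
    E = n₅ 2 ^₅ (n ∸ suc i)
    Z = n₅ 2 ^₅ i
    X = α ^₅ i
    Y = β ^₅ i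
    2^[n-j]*2^j≡2^n : E *₅ (n₅ 2 *₅ Z) ≡ n₅ 2 *₅ T
    2^[n-j]*2^j≡2^n = trans (sym (^₅-+ (n₅ 2) (n ∸ suc i) (suc i))) (cong (n₅ 2 ^₅_) (ℕP.m∸n+n≡m i<n))

  conj-f : ∀ j → conj (f j) ≡ f j
  conj-f j = begin
    conj (f j)
      ≡⟨ conj-*₅ c (α ^₅ suc j *₅ u +₅ β ^₅ j *₅ v) ⟩
    conj c *₅ conj (α ^₅ suc j *₅ u +₅ β ^₅ j *₅ v)
      ≡⟨ cong (conj c *₅_) (trans (conj-+₅ (α ^₅ suc j *₅ u) (β ^₅ j *₅ v)) (cong₂ _+₅_ (conj-*₅ (α ^₅ suc j) u) (conj-*₅ (β ^₅ j) v))) ⟩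
    conj c *₅ (conj (α ^₅ suc j) *₅ conj u +₅ conj (β ^₅ j) *₅ conj v)
      ≡⟨ cong₂ _*₅_ conj-c (cong₂ _+₅_ (cong₂ _*₅_ (conj-^₅ α (suc j)) conj-u) (cong₂ _*₅_ (conj-^₅ β j) conj-v)) ⟩
    c *₅ α *₅ (β ^₅ suc j *₅ v +₅ α ^₅ j *₅ u)
      ≡⟨ solve 5 (λ C X Y U V → C :* con α :* (con β :* Y :* V :+ X :* U) := C :* (con α :* X :* U :+ Y :* V)) refl c (α ^₅ j) (β ^₅ j) u v ⟩
    f j ∎
    where
    conj-u : conj u ≡ v
    conj-u = trans (conj-inv₅ Dα) (cong inv₅ conj-Dα)
    conj-v : conj v ≡ u
    conj-v = trans (conj-inv₅ Dβ) (cong inv₅ conj-Dβ)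
    conj-c : conj c ≡ c *₅ α
    conj-c = begin
      conj (-₅ (N *₅ ω *₅ (n₅ 2 *₅ T)))        ≡⟨ conj-neg₅ (N *₅ ω *₅ (n₅ 2 *₅ T)) ⟩
      -₅ conj (N *₅ ω *₅ (n₅ 2 *₅ T))          ≡⟨ cong -₅_ (conj-*₅ (N *₅ ω) (n₅ 2 *₅ T)) ⟩
      -₅ (conj (N *₅ ω) *₅ conj (n₅ 2 *₅ T))   ≡⟨ cong₂ (λ x y → -₅ (x *₅ y)) (conj-*₅ N ω) (conj-*₅ (n₅ 2) T) ⟩
      -₅ (N *₅ conj ω *₅ (n₅ 2 *₅ conj T))     ≡⟨ cong₂ (λ x y → -₅ (N *₅ x *₅ (n₅ 2 *₅ y))) conj-ω (conj-^₅ (n₅ 2) k) ⟩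
      -₅ (N *₅ (ω *₅ α) *₅ (n₅ 2 *₅ T))        ≡⟨ solve 2 (λ N′ T′ → :- (N′ :* (con ω :* con α) :* (con (n₅ 2) :* T′)) := :- (N′ :* con ω :* (con (n₅ 2) :* T′)) :* con α) refl N T ⟩
      c *₅ α                                    ∎

d : ℕ → ℕ → Q5
d n zero    = d₀ n
d n (suc j) = dⱼ n (suc j)

dvec≡d : ∀ n (x : Fin (pred n)) → dvec n x ≡ d n (toℕ x)
dvec≡d n x with toℕ x
... | zero  = refl
... | suc _ = refl

ι-3a-b-c : ∀ a b c → n₅ 3 *₅ ι a -₅ ι b -₅ ι c ≡ ι (ℕ→ℚ 3 ℚ.* a ℚ.- b ℚ.- c)
ι-3a-b-c a b c = cong₂ _+_√5
  (solve 3 (λ a b c → con (ℕ→ℚ 3) :* a :+ con (ℕ→ℚ 5) :* (con 0ℚ :* con 0ℚ) :+ :- b :+ :- c := con (ℕ→ℚ 3) :* a :- b :- c) refl a b c)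
  (solve 1 (λ a → con (ℕ→ℚ 3) :* con 0ℚ :+ con 0ℚ :* a :+ :- con 0ℚ :+ :- con 0ℚ := con 0ℚ) refl a)
  where open ℚ-Solver

module Coefficients (m : ℕ) where
  open ClosedForm (suc (suc m)) using (n; N; f; f-rec; f-wrap; f-wrap′; d₀≡f; dⱼ≡f; conj-f)
  open Shift (suc m) public
  open ≡-Reasoning

  d-0 : d n 0 ≡ f k′
  d-0 = d₀≡f

  d-suc : ∀ i → suc i < k → d n (suc i) ≡ f i
  d-suc i i<k = dⱼ≡f i (ℕP.<⇒≤ (ℕP.<-trans i<k (ℕP.n<1+n k)))

  d-next : ∀ t → t < k → d n (next t) ≡ f t
  d-next t t<k = cases (ℕP.m≤n⇒m<n∨m≡n t<k)
    where
    cases : suc t < k ⊎ suc t ≡ k → d n (next t) ≡ f t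
    cases (inj₁ 1+t<k) = trans (cong (d n) (m<n⇒m%n≡m 1+t<k)) (d-suc t 1+t<k)
    cases (inj₂ 1+t≡k) = begin
      d n (suc t % k)    ≡⟨ cong (λ s → d n (s % k)) 1+t≡k ⟩
      d n (k % k)        ≡⟨ cong (d n) (n%n≡0 k) ⟩
      d n 0              ≡⟨ d-0 ⟩
      f k′               ≡⟨ cong f (ℕP.suc-injective 1+t≡k) ⟨
      f t                ∎

  d-rational : ∀ t → t < k → ι (re (d n t)) ≡ d n t
  d-rational zero    _     = conj-fixed⇒rational (d n 0) (trans (cong conj d-0) (trans (conj-f k′) (sym d-0)))
  d-rational (suc i) 1+i<k = conj-fixed⇒rational (d n (suc i))
    (trans (cong conj (d-suc i 1+i<k)) (trans (conj-f i) (sym (d-suc i 1+i<k))))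

  f-rec₀ : ∀ j → n₅ 3 *₅ f (suc j) -₅ f (suc (suc j)) -₅ f j ≡ ι 0ℚ
  f-rec₀ j = trans (cong (λ z → n₅ 3 *₅ f (suc j) -₅ z -₅ f j) (f-rec j))
    (solve 2 (λ a b → con (n₅ 3) :* a :- (con (n₅ 3) :* a :- b) :- b := con (ι 0ℚ)) refl (f (suc j)) (f j))
    where open Q5-Solver

  d-rec : ∀ t → t < k → n₅ 3 *₅ d n t -₅ d n (next t) -₅ d n (prev t) ≡ ι (ℕ→ℚ n ℚ.* (δ t 0 ℚ.- δ t 1))
  d-rec zero _ = begin
    n₅ 3 *₅ d n 0 -₅ d n 1 -₅ d n (k′ % k)
      ≡⟨ cong₂ (λ x y → n₅ 3 *₅ x -₅ d n 1 -₅ y) d-0 (trans (cong (d n) k′%k≡k′) (d-suc (suc m) ℕP.≤-refl)) ⟩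
    n₅ 3 *₅ f k′ -₅ d n 1 -₅ f (suc m)
      ≡⟨ solve 3 (λ a b c → con (n₅ 3) :* a :- b :- c := (con (n₅ 3) :* a :- c) :- b) refl (f k′) (d n 1) (f (suc m)) ⟩
    (n₅ 3 *₅ f k′ -₅ f (suc m)) -₅ d n 1
      ≡⟨ cong₂ _-₅_ (f-rec (suc m)) (sym (d-suc 0 (s≤s (s≤s z≤n)))) ⟨
    f k -₅ f 0
      ≡⟨ f-wrap ⟩
    N
      ≡⟨ cong ι (ℚP.*-identityʳ (ℕ→ℚ n)) ⟨
    ι (ℕ→ℚ n ℚ.* (δ 0 0 ℚ.- δ 0 1))
      ∎
    where open Q5-Solver
  d-rec (suc zero) _ = begin
    n₅ 3 *₅ d n 1 -₅ d n 2 -₅ d n (k % k)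
      ≡⟨ cong₂ (λ x y → n₅ 3 *₅ x -₅ d n 2 -₅ y) (d-suc 0 (s≤s (s≤s z≤n))) (trans (cong (d n) (n%n≡0 k)) d-0) ⟩
    n₅ 3 *₅ f 0 -₅ d n 2 -₅ f k′
      ≡⟨ cong (λ x → n₅ 3 *₅ f 0 -₅ x -₅ f k′) (d-suc 1 (s≤s (s≤s (s≤s z≤n)))) ⟩
    n₅ 3 *₅ f 0 -₅ f 1 -₅ f k′
      ≡⟨ solve 3 (λ a b c → con (n₅ 3) :* a :- b :- c := con (n₅ 3) :* a :- c :- b) refl (f 0) (f 1) (f k′) ⟩
    n₅ 3 *₅ f 0 -₅ f k′ -₅ f 1
      ≡⟨ f-wrap′ ⟩
    -₅ N
      ≡⟨ cong ι (trans (sym (ℚP.neg-distribʳ-* (ℕ→ℚ n) 1ℚ)) (cong ℚ.-_ (ℚP.*-identityʳ (ℕ→ℚ n)))) ⟨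
    ι (ℕ→ℚ n ℚ.* (δ 1 0 ℚ.- δ 1 1))
      ∎
    where open Q5-Solver
  d-rec (suc (suc t)) 2+t<k = begin
    n₅ 3 *₅ d n (2 ℕ.+ t) -₅ d n (next (2 ℕ.+ t)) -₅ d n (prev (2 ℕ.+ t))
      ≡⟨ cong₂ (λ x y → n₅ 3 *₅ x -₅ y -₅ d n (prev (2 ℕ.+ t))) (d-suc (suc t) 2+t<k) (d-next (2 ℕ.+ t) 2+t<k) ⟩
    n₅ 3 *₅ f (suc t) -₅ f (2 ℕ.+ t) -₅ d n (prev (2 ℕ.+ t))
      ≡⟨ cong (λ x → n₅ 3 *₅ f (suc t) -₅ f (2 ℕ.+ t) -₅ x) (trans (cong (d n) prev-2+t) (d-suc t 1+t<k)) ⟩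
    n₅ 3 *₅ f (suc t) -₅ f (2 ℕ.+ t) -₅ f t
      ≡⟨ f-rec₀ t ⟩
    ι 0ℚ
      ≡⟨ cong ι (ℚP.*-zeroʳ (ℕ→ℚ n)) ⟨
    ι (ℕ→ℚ n ℚ.* (δ (2 ℕ.+ t) 0 ℚ.- δ (2 ℕ.+ t) 1))
      ∎
    where
    1+t<k : suc t < k
    1+t<k = ℕP.<-trans (ℕP.n<1+n (suc t)) 2+t<k
    prev-2+t : prev (2 ℕ.+ t) ≡ suc t
    prev-2+t = trans (cong (_% k) (sym (ℕP.+-suc (suc t) k′))) (+k%k≡ (suc t) 1+t<k)

  dℚ : ℕ → ℚ
  dℚ t = re (d n t)

  dℚ-rec : ∀ t → t < k → ℕ→ℚ 3 ℚ.* dℚ t ℚ.- dℚ (next t) ℚ.- dℚ (prev t) ≡ ℕ→ℚ n ℚ.* (δ t 0 ℚ.- δ t 1)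
  dℚ-rec t t<k = cong re (begin
    ι (ℕ→ℚ 3 ℚ.* dℚ t ℚ.- dℚ (next t) ℚ.- dℚ (prev t))
      ≡⟨ ι-3a-b-c (dℚ t) (dℚ (next t)) (dℚ (prev t)) ⟨
    n₅ 3 *₅ ι (dℚ t) -₅ ι (dℚ (next t)) -₅ ι (dℚ (prev t))
      ≡⟨ cong₂ (λ x y → n₅ 3 *₅ x -₅ y -₅ ι (dℚ (prev t))) (d-rational t t<k) (d-rational (next t) (next<k t)) ⟩
    n₅ 3 *₅ d n t -₅ d n (next t) -₅ ι (dℚ (prev t))
      ≡⟨ cong (λ z → n₅ 3 *₅ d n t -₅ d n (next t) -₅ z) (d-rational (prev t) (prev<k t)) ⟩
    n₅ 3 *₅ d n t -₅ d n (next t) -₅ d n (prev t)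
      ≡⟨ d-rec t t<k ⟩
    ι (ℕ→ℚ n ℚ.* (δ t 0 ℚ.- δ t 1))
      ∎)

  open CirculantSolution n dℚ dℚ-rec public

  circ-dvec : ∀ i j → circ k (dvec n) i j ≡ d n (offset (toℕ i) (toℕ j))
  circ-dvec i j = trans (dvec≡d n _) (cong (d n) (toℕ-fromℕ< (offset<k (toℕ i) (toℕ j))))

mainTheorem9 : (n : ℕ) → 4 ≤ n →
    let k = pred n
        C = Cmat k
        M = (C ⊗ transpose C) ⊕ I k
    in (Minv : Matrix k) → Minv ⊗ M ≡ I k →
    let X = Minv ⊗ (J k ⊖ (ℕ→ℚ n · I k))
        Y = neg (transpose C ⊗ X)
    in (i j : Fin k) → ι (Y i j) ≡ circ k (dvec n) i j
mainTheorem9 n@(suc (suc (suc (suc m)))) (s≤s (s≤s (s≤s (s≤s _)))) Minv Minv⊗M≡I i j = begin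
  ι (neg (transpose C ⊗ (Minv ⊗ W)) i j)     ≡⟨ cong ι (Y≡D Minv Minv⊗M≡I i j) ⟩
  ι (dℚ (offset (toℕ i) (toℕ j)))            ≡⟨ d-rational (offset (toℕ i) (toℕ j)) (offset<k (toℕ i) (toℕ j)) ⟩
  d n (offset (toℕ i) (toℕ j))               ≡⟨ circ-dvec i j ⟨
  circ k (dvec n) i j                        ∎
  where
  open Coefficients m
  open ≡-Reasoning
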